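{- Let $(A,V)$ and $(B,W)$ be permutation groups on finite sets, neither equal to $I_1$, with $A,B\in DGR\setminus GR$. Suppose that for every $b\in B'=\bar{B}\setminus B$ there exist two distinct paired Or-orbitals $O_1\neq O_2$ of $B$ such that $b$ does not pair $O_1$ and $O_2$ (i.e. $b(O_1)\neq O_2$). Then $A\times B\in GR$.
   Context: A permutation group $(A,V)$ is a group $A$ of permutations of a set $V$; $I_n$ denotes the trivial group acting on an $n$-element set; groups are considered up to permutation isomorphism. The direct product $A\times B$ acts on $V\times W$ by $(a,b)(x,y)=(a(x),b(y))$. An edge-colored graph on a set $U$ is a function $E$ from the 2-element subsets of $U$ to a finite set of colors, with automorphisms the permutations $\sigma$ of $U$ satisfying $E(\{\sigma(u),\sigma(u')\})=E(\{u,u'\})$ for all distinct $u,u'$; an edge-colored digraph is defined the same way with ordered pairs $(u,u')$, $u\neq u'$, in place of 2-element subsets. $GR$ (resp. $DGR$) is the class of permutation groups that equal the full automorphism group of some edge-colored graph (resp. digraph) on their underlying set. NOr-orbitals of $(B,W)$ are the orbits of $B$ on 2-element subsets of $W$; Or-orbitals are the orbits of $B$ on ordered pairs $(w,w')$ of distinct elements of $W$ under $b(w,w')=(b(w),b(w'))$. $\bar{B}$ is the smallest permutation group on $W$ containing $B$ and belonging to $GR$ (equivalently, all permutations of $W$ mapping every NOr-orbital of $B$ onto itself). Or-orbitals $O_1,O_2$ are paired if $O_2=\{(w',w):(w,w')\in O_1\}$; an Or-orbital is self-paired if paired with itself. A permutation $\sigma$ of $W$ pairs $O_1$ and $O_2$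 if $O_1\neq O_2$ are paired and $\sigma(O_1)=O_2$. -}

module Defs where

open import Data.Nat using (ℕ)
open import Data.Fin using (Fin)
open import Data.Product using (Σ; ∃; ∃-syntax; _×_; _,_; proj₁; proj₂)
open import Data.Sum using (_⊎_)
open import Relation.Nullary using (¬_)
open import Relation.Binary.PropositionalEquality using (_≡_; _≢_)
open import Function.Bundles using (_↔_; Inverse; mk↔ₛ′)
open import Function.Base using (_∘_; id)

Perm : Set → Set
Perm V = V ↔ V

module _ {V : Set} where
  open Inverse

  app : Perm V → V → V
  app σ = to σ

  idP : Perm V
  idP = mk↔ₛ′ id id (λ _ → _≡_.refl) (λ _ → _≡_.refl)

  _∘P_ : Perm V → Perm V → Perm V
  σ ∘P τ = mk↔ₛ′ (to σ ∘ to τ) (from τ ∘ from σ)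
    (λ x → Relation.Binary.PropositionalEquality.trans
             (Relation.Binary.PropositionalEquality.cong (to σ) (strictlyInverseˡ τ (from σ x)))
             (strictlyInverseˡ σ x))
    (λ x → Relation.Binary.PropositionalEquality.trans
             (Relation.Binary.PropositionalEquality.cong (from τ) (strictlyInverseʳ σ (to τ x)))
             (strictlyInverseʳ τ x))
    where import Relation.Binary.PropositionalEquality

  invP : Perm V → Perm V
  invP σ = mk↔ₛ′ (from σ) (to σ) (strictlyInverseʳ σ) (strictlyInverseˡ σ)

record IsPermGroup {V : Set} (G : Perm V → Set) : Set where
  field
    respects : ∀ σ τ → (∀ x → app σ x ≡ app τ x) → G σ → G τ
    has-id   : G idP
    closed-∘ : ∀ σ τ → G σ → G τ → G (σ ∘P τ)
    closed-⁻¹ : ∀ σ → G σ → G (invP σ)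

-- Automorphisms of an edge-coloured (di)graph given by a colouring c of
-- pairs of distinct vertices (values of c on the diagonal are ignored).
IsAut : {V : Set} {k : ℕ} → (V → V → Fin k) → Perm V → Set
IsAut c σ = ∀ x y → x ≢ y → c (app σ x) (app σ y) ≡ c x y

-- G ∈ GR: G is exactly the automorphism group of some edge-coloured graph
-- (colouring of 2-subsets = symmetric colouring of ordered distinct pairs).
GR : {V : Set} → (Perm V → Set) → Set
GR {V} G = ∃[ k ] Σ (V → V → Fin k) λ c →
  (∀ x y → c x y ≡ c y x) × (∀ σ → (G σ → IsAut c σ) × (IsAut c σ → G σ))

DGR : {V : Set} → (Perm V → Set) → Set
DGR {V} G = ∃[ k ] Σ (V → V → Fin k) λ c →
  (∀ σ → (G σ → IsAut c σ) × (IsAut c σ → G σ))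

PairSet : Set → Set₁
PairSet V = V → V → Set

Image : {V : Set} → Perm V → PairSet V → PairSet V
Image σ S x y = ∃[ a ] ∃[ b ] (S a b × app σ a ≡ x × app σ b ≡ y)

SameSet : {V : Set} → PairSet V → PairSet V → Set
SameSet S T = ∀ x y → (S x y → T x y) × (T x y → S x y)

OrOrb : {V : Set} → (Perm V → Set) → V → V → PairSet V
OrOrb B u u' x y = ∃[ b ] (B b × app b u ≡ x × app b u' ≡ y)

-- NOr-orbital of B containing the 2-subset {u,u'}, encoded as the symmetric
-- set of ordered pairs (x,y) with {x,y} in the orbit of {u,u'}.
NOrOrb : {V : Set} → (Perm V → Set) → V → V → PairSet V
NOrOrb B u u' x y =
  ∃[ b ] (B b × ((app b u ≡ x × app b u' ≡ y) ⊎ (app b u ≡ y × app b u' ≡ x)))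

Closure : {V : Set} → (Perm V → Set) → Perm V → Set
Closure B σ = ∀ u u' → u ≢ u' → SameSet (Image σ (NOrOrb B u u')) (NOrOrb B u u')

_×ᴳ_ : {V W : Set} → (Perm V → Set) → (Perm W → Set) → Perm (V × W) → Set
(A ×ᴳ B) τ = ∃[ a ] ∃[ b ] (A a × B b × (∀ p → app τ p ≡ (app a (proj₁ p) , app b (proj₂ p))))

-- Colour each 2-subset of V × W by its NOr-orbital under A × B; it remains to see that a permutation τ
-- preserving these orbitals lies in A × B. Such a τ splits as f × g, and on each pair of points f and g
-- either both keep the coordinates in their Or-orbitals or both carry them to the paired ones.
-- If g reversed every Or-orbital of B it would lie in B̄ and pair all of them, so g ∈ B by hypothesis;
-- but then every Or-orbital of B is self-paired and B ∈ GR. A pair not reversed by g forces f to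
-- preserve every Or-orbital of A, so f ∈ A as A ∈ DGR; by the same argument with A and B exchanged,
-- g ∈ B.
module Submission where

open import Defs
open import Data.Nat using (ℕ; zero; suc)
open import Data.Fin using (Fin; zero; suc)
open import Data.Fin.Properties using (all?; any?; _≟_; *↔×)
open import Data.Product using (Σ; ∃; ∃-syntax; _×_; _,_; proj₁; proj₂)
open import Data.Product.Properties using (,-injective)
open import Data.Product.Function.NonDependent.Propositional using (_×-↔_)
open import Data.Sum using (_⊎_; inj₁; inj₂)
import Data.Sum as Sum
open import Data.Empty using (⊥-elim)
open import Data.Vec.Functional using (_∷_; head; tail)
open import Relation.Nullary using (¬_; Dec; yes; no)
open import Relation.Nullary.Decidable using (map′; _×-dec_; _⊎-dec_; _→-dec_; ¬?; decidable-stable)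
open import Relation.Unary using (Pred; Decidable)
open import Relation.Binary.PropositionalEquality
open import Function.Base using (_∘_)
open import Function.Bundles using (_↔_; _⇔_; Inverse; Injection; Equivalence; mk↔ₛ′; mk⇔)
open import Function.Properties.Inverse using (↔⇒↣)
open import Function.Construct.Composition using (_↔-∘_)

Extensional : {A B : Set} → ((A → B) → Set) → Set
Extensional Q = ∀ {f g} → f ≗ g → Q f → Q g

∃-fun? : ∀ k {m} (Q : (Fin k → Fin m) → Set) →
  (∀ f → Dec (Q f)) → Extensional Q → Dec (∃ Q)
∃-fun? zero Q Q? ext =
  map′ (λ q → _ , q) (λ { (f , q) → ext (λ ()) q }) (Q? (λ ()))
∃-fun? (suc k) Q Q? ext =
  map′ (λ { (a , f , q) → a ∷ f , q })
       (λ { (f , q) → head f , tail f , ext (λ { zero → refl ; (suc i) → refl }) q })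
       (any? λ a → ∃-fun? k (Q ∘ (a ∷_)) (Q? ∘ (a ∷_))
                     (λ f≗g → ext (λ { zero → refl ; (suc i) → f≗g i })))

Extensionalᴾ : {V : Set} → (Perm V → Set) → Set
Extensionalᴾ P = ∀ {σ τ} → app σ ≗ app τ → P σ → P τ

∃-perm? : ∀ {k} (P : Perm (Fin k) → Set) →
  (∀ σ → Dec (P σ)) → Extensionalᴾ P → Dec (∃ P)
∃-perm? {k} P P? ext =
  map′ (λ { (f , g , l , r , p) → mk↔ₛ′ f g l r , p })
       (λ { (σ , p) → Inverse.to σ , Inverse.from σ ,
                      Inverse.strictlyInverseˡ σ , Inverse.strictlyInverseʳ σ , ext (λ _ → refl) p })
       (∃-fun? k _ (λ f → ∃-fun? k (PermWith f) (PermWith? f) extʳ) extˡ)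
  where
  PermWith : (Fin k → Fin k) → (Fin k → Fin k) → Set
  PermWith f g = Σ (∀ y → f (g y) ≡ y) λ l → Σ (∀ x → g (f x) ≡ x) λ r → P (mk↔ₛ′ f g l r)

  PermWith? : ∀ f g → Dec (PermWith f g)
  PermWith? f g with all? (λ y → f (g y) ≟ y) | all? (λ x → g (f x) ≟ x)
  ... | no ¬l | _    = no (¬l ∘ proj₁)
  ... | yes _ | no ¬r = no (¬r ∘ proj₁ ∘ proj₂)
  ... | yes l | yes r =
    map′ (λ p → l , r , p) (λ { (_ , _ , p) → ext (λ _ → refl) p }) (P? (mk↔ₛ′ f g l r))

  extʳ : ∀ {f} → Extensional (PermWith f)
  extʳ {f} g≗g' (l , r , p) =
    (λ y → trans (cong f (sym (g≗g' y))) (l y)) ,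
    (λ x → trans (sym (g≗g' (f x))) (r x)) , ext (λ _ → refl) p

  extˡ : Extensional (λ f → ∃ (PermWith f))
  extˡ {f} {f'} f≗f' (g , l , r , p) =
    g , (λ y → trans (sym (f≗f' (g y))) (l y)) ,
    (λ x → trans (cong g (sym (f≗f' x))) (r x)) , ext f≗f' p

-- The last index if P holds nowhere.
least : ∀ {k p} {P : Pred (Fin (suc k)) p} → Decidable P → Fin (suc k)
least {zero}  P? = zero
least {suc k} P? with P? zero
... | yes _ = zero
... | no _  = suc (least (P? ∘ suc))

least-satisfies : ∀ {k p} {P : Pred (Fin (suc k)) p} (P? : Decidable P) → ∃ P → P (least P?)
least-satisfies {zero}  P? (zero , p) = p
least-satisfies {suc k} P? (i , p) with P? zero
... | yes p₀ = p₀
least-satisfies {suc k} P? (zero  , p) | no ¬p₀ = ⊥-elim (¬p₀ p)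
least-satisfies {suc k} P? (suc i , p) | no _   = least-satisfies (P? ∘ suc) (i , p)

least-cong : ∀ {k p q} {P : Pred (Fin (suc k)) p} {Q : Pred (Fin (suc k)) q}
  (P? : Decidable P) (Q? : Decidable Q) →
  (∀ i → P i → Q i) → (∀ i → Q i → P i) → least P? ≡ least Q?
least-cong {zero}  P? Q? P⇒Q Q⇒P = refl
least-cong {suc k} P? Q? P⇒Q Q⇒P with P? zero | Q? zero
... | yes _  | yes _  = refl
... | yes p  | no ¬q  = ⊥-elim (¬q (P⇒Q zero p))
... | no ¬p  | yes q  = ⊥-elim (¬p (Q⇒P zero q))
... | no _   | no _   =
  cong suc (least-cong (P? ∘ suc) (Q? ∘ suc) (P⇒Q ∘ suc) (Q⇒P ∘ suc))

counterexample : ∀ {k} {R : Fin k → Fin k → Set} → (∀ x y → Dec (R x y)) →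
  ¬ (∀ x y → x ≢ y → R x y) → ∃[ x ] ∃[ y ] (x ≢ y × ¬ R x y)
counterexample R? ¬all with any? (λ x → any? (λ y → ¬? (x ≟ y) ×-dec ¬? (R? x y)))
... | yes c  = c
... | no ¬c = ⊥-elim (¬all λ x y x≢y → decidable-stable (R? x y) (λ ¬r → ¬c (x , y , x≢y , ¬r)))

app-injective : ∀ {V : Set} (σ : Perm V) {a b} → app σ a ≡ app σ b → a ≡ b
app-injective σ = Injection.injective (↔⇒↣ σ)

module _ {V : Set} {G : Perm V → Set} where

  OrOrb-flip : ∀ {x y a b} → OrOrb G x y a b → OrOrb G y x b a
  OrOrb-flip (g , g∈G , e₁ , e₂) = g , g∈G , e₂ , e₁

  OrOrb-diagonal : ∀ {x a b} → OrOrb G x x a b → a ≡ b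
  OrOrb-diagonal (_ , _ , e₁ , e₂) = trans (sym e₁) e₂

  OrOrb-distinct : ∀ {x y a b} → OrOrb G x y a b → x ≢ y → a ≢ b
  OrOrb-distinct (g , _ , e₁ , e₂) x≢y a≡b = x≢y (app-injective g (trans e₁ (trans a≡b (sym e₂))))

  Or⇒NOr : ∀ {u u' x y} → OrOrb G u u' x y → NOrOrb G u u' x y
  Or⇒NOr (g , g∈G , e) = g , g∈G , inj₁ e

  Or⇒NOr-swapped : ∀ {u u' x y} → OrOrb G u u' y x → NOrOrb G u u' x y
  Or⇒NOr-swapped (g , g∈G , e) = g , g∈G , inj₂ e

  NOrOrb-swap : ∀ {u u' x y} → NOrOrb G u u' x y → NOrOrb G u u' y x
  NOrOrb-swap (g , g∈G , e) = g , g∈G , Sum.swap e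

  module _ (isG : IsPermGroup G) where
    open IsPermGroup isG

    OrOrb-refl : ∀ x y → OrOrb G x y x y
    OrOrb-refl x y = idP , has-id , refl , refl

    OrOrb-sym : ∀ {x y a b} → OrOrb G x y a b → OrOrb G a b x y
    OrOrb-sym (g , g∈G , e₁ , e₂) =
      invP g , closed-⁻¹ g g∈G , Inverse.inverseʳ g (sym e₁) , Inverse.inverseʳ g (sym e₂)

    OrOrb-trans : ∀ {x y a b c d} → OrOrb G x y a b → OrOrb G a b c d → OrOrb G x y c d
    OrOrb-trans (g , g∈G , e₁ , e₂) (h , h∈G , f₁ , f₂) =
      h ∘P g , closed-∘ h g h∈G g∈G , trans (cong (app h) e₁) f₁ , trans (cong (app h) e₂) f₂

    NOrOrb-sym : ∀ {u u' x y} → NOrOrb G u u' x y → NOrOrb G x y u u'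
    NOrOrb-sym (g , g∈G , inj₁ e) = Or⇒NOr (OrOrb-sym (g , g∈G , e))
    NOrOrb-sym (g , g∈G , inj₂ e) = Or⇒NOr-swapped (OrOrb-flip (OrOrb-sym (g , g∈G , e)))

    NOrOrb-trans : ∀ {u u' x y z z'} → NOrOrb G u u' x y → NOrOrb G x y z z' → NOrOrb G u u' z z'
    NOrOrb-trans (g , g∈G , inj₁ e) (h , h∈G , inj₁ f) = Or⇒NOr (OrOrb-trans (g , g∈G , e) (h , h∈G , f))
    NOrOrb-trans (g , g∈G , inj₁ e) (h , h∈G , inj₂ f) = Or⇒NOr-swapped (OrOrb-trans (g , g∈G , e) (h , h∈G , f))
    NOrOrb-trans (g , g∈G , inj₂ e) (h , h∈G , inj₁ f) =
      Or⇒NOr-swapped (OrOrb-trans (g , g∈G , e) (OrOrb-flip (h , h∈G , f)))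
    NOrOrb-trans (g , g∈G , inj₂ e) (h , h∈G , inj₂ f) =
      Or⇒NOr (OrOrb-trans (g , g∈G , e) (OrOrb-flip (h , h∈G , f)))

Preserves Reverses : {V : Set} → (Perm V → Set) → Perm V → V → V → Set
Preserves G h x y = OrOrb G x y (app h x) (app h y)
Reverses G h x y = OrOrb G x y (app h y) (app h x)

ReversesAll : {V : Set} → (Perm V → Set) → Perm V → Set
ReversesAll G h = ∀ x y → x ≢ y → Reverses G h x y

PairsOrOrbitals : {V : Set} → (Perm V → Set) → Perm V → Set
PairsOrOrbitals G h = ∀ u u' → u ≢ u' → SameSet (Image h (OrOrb G u u')) (OrOrb G u' u)

module _ {V : Set} {G : Perm V → Set} (isG : IsPermGroup G) (h : Perm V) where

  self-paired-if-reversed : ∀ {x y} → Preserves G h y x → Reverses G h x y → OrOrb G x y y x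
  self-paired-if-reversed pres rev = OrOrb-trans isG rev (OrOrb-sym isG pres)

  reversesAll⇒pairs : ReversesAll G h → PairsOrOrbitals G h
  reversesAll⇒pairs rev u u' u≢u' x y = to , from
    where
    to : Image h (OrOrb G u u') x y → OrOrb G u' u x y
    to (a , b , o , ha≡x , hb≡y) = OrOrb-flip (OrOrb-trans isG o
      (subst₂ (OrOrb G a b) hb≡y ha≡x (rev a b (OrOrb-distinct o u≢u'))))

    from : OrOrb G u' u x y → Image h (OrOrb G u u') x y
    from o = a , b , OrOrb-trans isG (OrOrb-flip o) (OrOrb-sym isG r) , h∘from≗id x , h∘from≗id y
      where
      h∘from≗id : ∀ z → app h (Inverse.from h z) ≡ z
      h∘from≗id = Inverse.strictlyInverseˡ h
      a b : V
      a = Inverse.from h x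
      b = Inverse.from h y
      r : OrOrb G a b y x
      r = subst₂ (OrOrb G a b) (h∘from≗id y) (h∘from≗id x)
        (rev a b (λ a≡b → OrOrb-distinct o (u≢u' ∘ sym) (app-injective (invP h) a≡b)))

  reversesAll⇒closure : ReversesAll G h → Closure G h
  reversesAll⇒closure rev u u' u≢u' x y = to , from
    where
    pairs : SameSet (Image h (OrOrb G u u')) (OrOrb G u' u)
    pairs = reversesAll⇒pairs rev u u' u≢u'

    to : Image h (NOrOrb G u u') x y → NOrOrb G u u' x y
    to (a , b , (g , g∈G , inj₁ e) , ha , hb) =
      Or⇒NOr-swapped (OrOrb-flip (proj₁ (pairs x y) (a , b , (g , g∈G , e) , ha , hb)))
    to (a , b , (g , g∈G , inj₂ e) , ha , hb) =
      Or⇒NOr (OrOrb-flip (proj₁ (pairs y x) (b , a , (g , g∈G , e) , hb , ha)))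

    from : NOrOrb G u u' x y → Image h (NOrOrb G u u') x y
    from (g , g∈G , inj₁ e) with proj₂ (pairs y x) (OrOrb-flip (g , g∈G , e))
    ... | a , b , o , ha , hb = b , a , Or⇒NOr-swapped o , hb , ha
    from (g , g∈G , inj₂ e) with proj₂ (pairs x y) (OrOrb-flip (g , g∈G , e))
    ... | a , b , o , ha , hb = a , b , Or⇒NOr o , ha , hb

PreservesNOrOrbitals : {V : Set} → (Perm V → Set) → Perm V → Set
PreservesNOrOrbitals G τ = ∀ p q → p ≢ q → NOrOrb G p q (app τ p) (app τ q)

-- {x,y} is coloured by the least index of a pair in its NOr-orbital, so the colour classes are
-- exactly the NOr-orbitals.
GR-if-closed : ∀ {V : Set} {G : Perm V → Set} {k} → IsPermGroup G →
  (∀ u u' x y → Dec (NOrOrb G u u' x y)) → Fin (suc k) ↔ (V × V) →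
  (∀ τ → PreservesNOrOrbitals G τ → G τ) → GR G
GR-if-closed {V} {G} {k} isG NOr? pairs closed =
  suc k , colour , colour-sym , λ σ → colour-invariant σ , closed σ ∘ colour-preserving σ
  where

  InOrbital : Fin (suc k) → V → V → Set
  InOrbital i = NOrOrb G (proj₁ (Inverse.to pairs i)) (proj₂ (Inverse.to pairs i))

  InOrbital? : ∀ x y → Decidable (λ i → InOrbital i x y)
  InOrbital? x y i = NOr? _ _ x y

  colour : V → V → Fin (suc k)
  colour x y = least (InOrbital? x y)

  in-own-orbital : ∀ x y → InOrbital (colour x y) x y
  in-own-orbital x y = least-satisfies (InOrbital? x y)
    (Inverse.from pairs (x , y) ,
     subst (λ t → NOrOrb G (proj₁ t) (proj₂ t) x y) (sym (Inverse.strictlyInverseˡ pairs (x , y)))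
       (Or⇒NOr (OrOrb-refl isG x y)))

  colour-sym : ∀ x y → colour x y ≡ colour y x
  colour-sym x y = least-cong (InOrbital? x y) (InOrbital? y x) (λ _ → NOrOrb-swap) (λ _ → NOrOrb-swap)

  colour-invariant : ∀ σ → G σ → IsAut colour σ
  colour-invariant σ σ∈G x y _ = least-cong (InOrbital? _ _) (InOrbital? x y)
    (λ _ o → NOrOrb-trans isG o (NOrOrb-sym isG moved))
    (λ _ o → NOrOrb-trans isG o moved)
    where
    moved : NOrOrb G x y (app σ x) (app σ y)
    moved = Or⇒NOr (σ , σ∈G , refl , refl)

  colour-preserving : ∀ τ → IsAut colour τ → PreservesNOrOrbitals G τ
  colour-preserving τ aut p q p≢q = NOrOrb-trans isG (NOrOrb-sym isG (in-own-orbital p q))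
    (subst (λ i → InOrbital i (app τ p) (app τ q)) (aut p q p≢q) (in-own-orbital (app τ p) (app τ q)))

module _ {k : ℕ} {G : Perm (Fin k) → Set} (dgr : DGR G) where
  private
    c : Fin k → Fin k → Fin (proj₁ dgr)
    c = proj₁ (proj₂ dgr)

    aut⇔∈ : ∀ σ → (G σ → IsAut c σ) × (IsAut c σ → G σ)
    aut⇔∈ = proj₂ (proj₂ dgr)

    orbit-colour : ∀ {x y a b} → OrOrb G x y a b → x ≢ y → c a b ≡ c x y
    orbit-colour {x} {y} (g , g∈G , e₁ , e₂) x≢y =
      subst₂ (λ a b → c a b ≡ c x y) e₁ e₂ (proj₁ (aut⇔∈ g) g∈G x y x≢y)

  DGR-member? : ∀ σ → Dec (G σ)
  DGR-member? σ = map′ (proj₂ (aut⇔∈ σ)) (proj₁ (aut⇔∈ σ))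
    (all? λ x → all? λ y → ¬? (x ≟ y) →-dec (c (app σ x) (app σ y) ≟ c x y))

  DGR-extensional : Extensionalᴾ G
  DGR-extensional {σ} {τ} σ≗τ σ∈G =
    proj₂ (aut⇔∈ τ) λ x y → orbit-colour (σ , σ∈G , σ≗τ x , σ≗τ y)

  OrOrb? : ∀ x y a b → Dec (OrOrb G x y a b)
  OrOrb? x y a b = ∃-perm? _ (λ σ → DGR-member? σ ×-dec (app σ x ≟ a) ×-dec (app σ y ≟ b))
    (λ { σ≗τ (σ∈G , e₁ , e₂) → DGR-extensional σ≗τ σ∈G , trans (sym (σ≗τ x)) e₁ , trans (sym (σ≗τ y)) e₂ })

  preservesAll⇒∈ : ∀ h → (∀ x y → x ≢ y → Preserves G h x y) → G h
  preservesAll⇒∈ h pres = proj₂ (aut⇔∈ h) λ x y x≢y → orbit-colour (pres x y x≢y) x≢y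

  self-paired⇒GR : (∀ x y → x ≢ y → OrOrb G x y y x) → GR G
  self-paired⇒GR swap = proj₁ dgr , c , c-sym , aut⇔∈
    where
    c-sym : ∀ x y → c x y ≡ c y x
    c-sym x y with x ≟ y
    ... | yes refl = refl
    ... | no x≢y = sym (orbit-colour (swap x y x≢y) x≢y)

Reverses? : ∀ {k} {G : Perm (Fin k) → Set} → DGR G → ∀ h x y → Dec (Reverses G h x y)
Reverses? dgr h x y = OrOrb? dgr x y (app h y) (app h x)

-- An element of G reversing every Or-orbital shows them all self-paired.
reversesAll-absurd : ∀ {k} {G : Perm (Fin k) → Set} {h} → IsPermGroup G → DGR G → ¬ GR G →
  (Closure G h → PairsOrOrbitals G h → ¬ ¬ G h) → ¬ ReversesAll G h
reversesAll-absurd {h = h} isG dgr ¬GR pairing⇒∈ rev =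
  pairing⇒∈ (reversesAll⇒closure isG h rev) (reversesAll⇒pairs isG h rev) λ h∈G →
    ¬GR (self-paired⇒GR dgr λ x y x≢y →
      self-paired-if-reversed isG h (h , h∈G , refl , refl) (rev x y x≢y))

module _ {V W : Set} {A : Perm V → Set} {B : Perm W → Set} where

  ×ᴳ-isPermGroup : IsPermGroup A → IsPermGroup B → IsPermGroup (A ×ᴳ B)
  ×ᴳ-isPermGroup isA isB = record
    { respects  = λ { σ τ σ≗τ (α , β , α∈A , β∈B , σ≗) → α , β , α∈A , β∈B , λ p → trans (sym (σ≗τ p)) (σ≗ p) }
    ; has-id    = idP , idP , A.has-id , B.has-id , λ _ → refl
    ; closed-∘  = λ { σ τ (α , β , α∈A , β∈B , σ≗) (α' , β' , α'∈A , β'∈B , τ≗) →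
        α ∘P α' , β ∘P β' , A.closed-∘ α α' α∈A α'∈A , B.closed-∘ β β' β∈B β'∈B ,
        λ p → trans (cong (app σ) (τ≗ p)) (σ≗ _) }
    ; closed-⁻¹ = λ { σ (α , β , α∈A , β∈B , σ≗) →
        invP α , invP β , A.closed-⁻¹ α α∈A , B.closed-⁻¹ β β∈B ,
        λ p → Inverse.inverseʳ σ (sym (trans (σ≗ _)
                (cong₂ _,_ (Inverse.strictlyInverseˡ α _) (Inverse.strictlyInverseˡ β _)))) }
    }
    where
    module A = IsPermGroup isA
    module B = IsPermGroup isB

  NOrOrb-×ᴳ : ∀ {v w v' w' x y x' y'} →
    NOrOrb (A ×ᴳ B) (v , w) (v' , w') (x , y) (x' , y') ⇔
    ((OrOrb A v v' x x' × OrOrb B w w' y y') ⊎ (OrOrb A v v' x' x × OrOrb B w w' y' y))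
  NOrOrb-×ᴳ {v} {w} {v'} {w'} {x} {y} {x'} {y'} = mk⇔ to from
    where
    Componentwise : Set
    Componentwise = (OrOrb A v v' x x' × OrOrb B w w' y y') ⊎ (OrOrb A v v' x' x × OrOrb B w w' y' y)

    to : NOrOrb (A ×ᴳ B) (v , w) (v' , w') (x , y) (x' , y') → Componentwise
    to (τ , (α , β , α∈A , β∈B , τ≗) , inj₁ (e₁ , e₂)) with ,-injective (trans (sym (τ≗ _)) e₁)
                                                         | ,-injective (trans (sym (τ≗ _)) e₂)
    ... | a₁ , b₁ | a₂ , b₂ = inj₁ ((α , α∈A , a₁ , a₂) , (β , β∈B , b₁ , b₂))
    to (τ , (α , β , α∈A , β∈B , τ≗) , inj₂ (e₁ , e₂)) with ,-injective (trans (sym (τ≗ _)) e₁)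
                                                         | ,-injective (trans (sym (τ≗ _)) e₂)
    ... | a₁ , b₁ | a₂ , b₂ = inj₂ ((α , α∈A , a₁ , a₂) , (β , β∈B , b₁ , b₂))

    from : Componentwise → NOrOrb (A ×ᴳ B) (v , w) (v' , w') (x , y) (x' , y')
    from (inj₁ ((α , α∈A , a₁ , a₂) , (β , β∈B , b₁ , b₂))) =
      (α ×-↔ β) , (α , β , α∈A , β∈B , λ _ → refl) , inj₁ (cong₂ _,_ a₁ b₁ , cong₂ _,_ a₂ b₂)
    from (inj₂ ((α , α∈A , a₁ , a₂) , (β , β∈B , b₁ , b₂))) =
      (α ×-↔ β) , (α , β , α∈A , β∈B , λ _ → refl) , inj₂ (cong₂ _,_ a₁ b₁ , cong₂ _,_ a₂ b₂)

module _ {V W : Set} (τ : Perm (V × W)) {f : V → V} {g : W → W}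
         (τ-split : ∀ v w → app τ (v , w) ≡ (f v , g w)) where

  leftFactor : W → Perm V
  leftFactor w₀ = mk↔ₛ′ f (λ x → proj₁ (Inverse.from τ (x , g w₀)))
    (λ x → cong proj₁ (trans (sym (τ-split _ _)) (Inverse.strictlyInverseˡ τ (x , g w₀))))
    (λ v → cong proj₁ (Inverse.inverseʳ τ (sym (τ-split v w₀))))

  rightFactor : V → Perm W
  rightFactor v₀ = mk↔ₛ′ g (λ y → proj₂ (Inverse.from τ (f v₀ , y)))
    (λ y → cong proj₂ (trans (sym (τ-split _ _)) (Inverse.strictlyInverseˡ τ (f v₀ , y))))
    (λ w → cong proj₂ (Inverse.inverseʳ τ (sym (τ-split v₀ w))))

module Splitting {n m : ℕ} {A : Perm (Fin n) → Set} {B : Perm (Fin m) → Set}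
  (τ : Perm (Fin n × Fin m)) (pres : PreservesNOrOrbitals (A ×ᴳ B) τ) (v₀ : Fin n) (w₀ : Fin m) where

  first-independent : ∀ v w w' → proj₁ (app τ (v , w)) ≡ proj₁ (app τ (v , w'))
  first-independent v w w' with w ≟ w'
  ... | yes refl = refl
  ... | no w≢w' with Equivalence.to NOrOrb-×ᴳ (pres (v , w) (v , w') (w≢w' ∘ cong proj₂))
  ... | inj₁ (o , _) = OrOrb-diagonal o
  ... | inj₂ (o , _) = sym (OrOrb-diagonal o)

  second-independent : ∀ w v v' → proj₂ (app τ (v , w)) ≡ proj₂ (app τ (v' , w))
  second-independent w v v' with v ≟ v'
  ... | yes refl = refl
  ... | no v≢v' with Equivalence.to NOrOrb-×ᴳ (pres (v , w) (v' , w) (v≢v' ∘ cong proj₁))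
  ... | inj₁ (_ , o) = OrOrb-diagonal o
  ... | inj₂ (_ , o) = sym (OrOrb-diagonal o)

  f : Fin n → Fin n
  f v = proj₁ (app τ (v , w₀))

  g : Fin m → Fin m
  g w = proj₂ (app τ (v₀ , w))

  τ-split : ∀ v w → app τ (v , w) ≡ (f v , g w)
  τ-split v w = cong₂ _,_ (first-independent v w w₀) (second-independent w v v₀)

  fP : Perm (Fin n)
  fP = leftFactor τ τ-split w₀

  gP : Perm (Fin m)
  gP = rightFactor τ τ-split v₀

  components : ∀ {v w v' w'} → (v , w) ≢ (v' , w') →
    (Preserves A fP v v' × Preserves B gP w w') ⊎ (Reverses A fP v v' × Reverses B gP w w')
  components {v} {w} {v'} {w'} p≢q = Equivalence.to NOrOrb-×ᴳ
    (subst₂ (NOrOrb (A ×ᴳ B) (v , w) (v' , w')) (τ-split v w) (τ-split v' w') (pres _ _ p≢q))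

NOrOrb-×ᴳ? : ∀ {n m} {A : Perm (Fin n) → Set} {B : Perm (Fin m) → Set} → DGR A → DGR B →
  ∀ p q r s → Dec (NOrOrb (A ×ᴳ B) p q r s)
NOrOrb-×ᴳ? dA dB (v , w) (v' , w') (x , y) (x' , y') =
  map′ (Equivalence.from NOrOrb-×ᴳ) (Equivalence.to NOrOrb-×ᴳ)
    ((OrOrb? dA v v' x x' ×-dec OrOrb? dB w w' y y') ⊎-dec (OrOrb? dA v v' x' x ×-dec OrOrb? dB w w' y' y))

×ᴳ-closed : ∀ {n m} {A : Perm (Fin n) → Set} {B : Perm (Fin m) → Set} →
  IsPermGroup A → IsPermGroup B → DGR A → DGR B → ¬ GR A → ¬ GR B →
  (∀ σ → Closure B σ → PairsOrOrbitals B σ → ¬ ¬ B σ) → Fin n → Fin m →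
  ∀ τ → PreservesNOrOrbitals (A ×ᴳ B) τ → (A ×ᴳ B) τ
×ᴳ-closed {A = A} {B} isA isB dA dB ¬GRA ¬GRB pairing⇒∈B v₀ w₀ τ pres =
  fP , gP , f∈A , g∈B , λ p → τ-split (proj₁ p) (proj₂ p)
  where
  open Splitting τ pres v₀ w₀

  f-preserves : ∀ {w w'} → ¬ Reverses B gP w w' → ∀ x y → x ≢ y → Preserves A fP x y
  f-preserves {w} {w'} ¬rev x y x≢y with components {x} {w} {y} {w'} (x≢y ∘ cong proj₁)
  ... | inj₁ (pres-f , _) = pres-f
  ... | inj₂ (_ , rev)    = ⊥-elim (¬rev rev)

  g-preserves : ∀ {v v'} → v ≢ v' → ¬ Reverses A fP v v' → ∀ x y → x ≢ y → Preserves B gP x y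
  g-preserves {v} {v'} v≢v' ¬rev x y _ with components {v} {x} {v'} {y} (v≢v' ∘ cong proj₁)
  ... | inj₁ (_ , pres-g) = pres-g
  ... | inj₂ (rev , _)    = ⊥-elim (¬rev rev)

  f∈A : A fP
  f∈A = let (_ , _ , _ , ¬rev) = counterexample (Reverses? dB gP)
                                   (reversesAll-absurd isB dB ¬GRB (pairing⇒∈B gP))
        in preservesAll⇒∈ dA fP (f-preserves ¬rev)

  g∈B : B gP
  g∈B = let (_ , _ , v≢v' , ¬rev) = counterexample (Reverses? dA fP)
                                      (reversesAll-absurd isA dA ¬GRA (λ _ _ f∉A → f∉A f∈A))
        in preservesAll⇒∈ dB gP (g-preserves v≢v' ¬rev)

lemma3p12 : (n m : ℕ) (A : Perm (Fin n) → Set) (B : Perm (Fin m) → Set) →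
    IsPermGroup A → IsPermGroup B →
    n ≢ 1 → m ≢ 1 →
    DGR A → ¬ GR A → DGR B → ¬ GR B →
    (∀ σ → Closure B σ → ¬ B σ →
      ∃[ u ] ∃[ u' ] (u ≢ u' × ¬ SameSet (OrOrb B u u') (OrOrb B u' u)
        × ¬ SameSet (Image σ (OrOrb B u u')) (OrOrb B u' u))) →
    GR (A ×ᴳ B)
lemma3p12 zero m A B isA isB _ _ dA ¬GRA dB ¬GRB hyp = ⊥-elim (¬GRA (self-paired⇒GR dA λ ()))
lemma3p12 (suc n) zero A B isA isB _ _ dA ¬GRA dB ¬GRB hyp = ⊥-elim (¬GRB (self-paired⇒GR dB λ ()))
lemma3p12 (suc n) (suc m) A B isA isB _ _ dA ¬GRA dB ¬GRB hyp =
  GR-if-closed (×ᴳ-isPermGroup isA isB) (NOrOrb-×ᴳ? dA dB) ((*↔× ×-↔ *↔×) ↔-∘ *↔×)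
    (×ᴳ-closed isA isB dA dB ¬GRA ¬GRB pairing⇒∈B zero zero)
  where
  pairing⇒∈B : ∀ σ → Closure B σ → PairsOrOrbitals B σ → ¬ ¬ B σ
  pairing⇒∈B σ closure pairing σ∉B =
    let (u , u' , u≢u' , _ , ¬pairs) = hyp σ closure σ∉B in ¬pairs (pairing u u' u≢u')
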